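{- Let $(H_{\mathbf{k}})$, $\mathbf{k}\in\mathbb{N}^h$, be a polynomial (respectively strongly polynomial) sequence of edge-weighted graphs, where $H_{\mathbf{k}}$ has weighted adjacency matrix $(a^{\mathbf{k}}_{i,j})$. For given constants $\alpha,\beta,\alpha',\beta'$, let $\widetilde{H}_{\mathbf{k}}$ be the edge-weighted graph with $V(\widetilde{H}_{\mathbf{k}})=V(H_{\mathbf{k}})$, weight $\alpha+\beta a^{\mathbf{k}}_{i,j}$ on each non-loop pair $i\ne j$ and weight $\alpha'+\beta' a^{\mathbf{k}}_{i,i}$ on the loop at $i$. Then $(\widetilde{H}_{\mathbf{k}})$ is polynomial (respectively strongly polynomial).
   Context: A weighted graph $H$ is given by a symmetric matrix $(a_{i,j})_{i,j\in V(H)}$ of weights (diagonal entries are loop weights). For a finite multigraph $G$, $\mathrm{hom}(G,H)=\sum_{f:V(G)\to V(H)}\prod_{uv\in E(G)}a_{f(u),f(v)}$, edges counted with multiplicity. $\mathbb{N}$ denotes the positive integers. A sequence $(H_{\mathbf{k}})$ indexed by all $\mathbf{k}\in\mathbb{N}^h$ is polynomial if for every graph $G$ there are finitely many polynomials $p_1(G;\mathbf{x}),\dots,p_m(G;\mathbf{x})$ such that for every $\mathbf{k}$, $\mathrm{hom}(G,H_{\mathbf{k}})=p_\ell(G;\mathbf{k})$ for some $\ell$; it is strongly polynomial if a single polynomial $p(G;\mathbf{x})$ works for all $\mathbf{k}$. -}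

module Defs where

open import Level using (_⊔_)
open import Algebra.Bundles using (CommutativeRing)
open import Data.Nat as ℕ using (ℕ; zero; suc)
open import Data.Fin as Fin using (Fin)
open import Data.Fin.Properties using (_≟_)
open import Data.Product using (_×_; _,_; Σ; ∃)
open import Data.List using (List; []; _∷_)
open import Data.List.Relation.Unary.Any using (Any)
open import Relation.Nullary using (yes; no)
import Data.Empty
import Relation.Binary.PropositionalEquality as P

-- A finite multigraph: vertex set Fin m, edges a list of (unordered) endpoint
-- pairs (loops allowed, multiplicity = number of occurrences in the list).
record Multigraph : Set where
  constructor mkMultigraph
  field
    nV    : ℕ
    edges : List (Fin nV × Fin nV)
open Multigraph public

data Poly {c} (C : Set c) (h : ℕ) : Set c where
  const : C → Poly C h
  var   : Fin h → Poly C h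
  _⊕_   : Poly C h → Poly C h → Poly C h
  _⊗_   : Poly C h → Poly C h → Poly C h

-- k ∈ ℕ^h with ℕ the positive integers
AllPos : ∀ {h} → (Fin h → ℕ) → Set
AllPos {h} k = (i : Fin h) → 1 ℕ.≤ k i

module _ {c ℓ} (R : CommutativeRing c ℓ) where
  open CommutativeRing R

  record WGraph : Set (c ⊔ ℓ) where
    constructor mkWGraph
    field
      nVert : ℕ
      wt    : Fin nVert → Fin nVert → Carrier
      sym-wt : ∀ i j → wt i j ≈ wt j i
  open WGraph public

  sumFin : (n : ℕ) → (Fin n → Carrier) → Carrier
  sumFin zero    f = 0#
  sumFin (suc n) f = f Fin.zero + sumFin n (λ i → f (Fin.suc i))

  sumMaps : (m n : ℕ) → ((Fin m → Fin n) → Carrier) → Carrier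
  sumMaps zero    n F = F (λ ())
  sumMaps (suc m) n F =
    sumFin n (λ i → sumMaps m n (λ g → F (λ { Fin.zero → i ; (Fin.suc x) → g x })))

  prodEdges : ∀ {m n} → (Fin n → Fin n → Carrier) → (Fin m → Fin n)
            → List (Fin m × Fin m) → Carrier
  prodEdges a f []            = 1#
  prodEdges a f ((u , v) ∷ es) = a (f u) (f v) * prodEdges a f es

  hom : Multigraph → WGraph → Carrier
  hom G H = sumMaps (nV G) (nVert H) (λ f → prodEdges (wt H) f (edges G))

  ι : ℕ → Carrier
  ι zero    = 0#
  ι (suc n) = 1# + ι n

  eval : ∀ {h} → Poly Carrier h → (Fin h → ℕ) → Carrier
  eval (const x) k = x
  eval (var i)   k = ι (k i)
  eval (p ⊕ q)   k = eval p k + eval q k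
  eval (p ⊗ q)   k = eval p k * eval q k

  IsPolynomial : ∀ {h} → ((Fin h → ℕ) → WGraph) → Set (c ⊔ ℓ)
  IsPolynomial {h} H = (G : Multigraph) → Σ (List (Poly Carrier h)) λ ps →
    (k : Fin h → ℕ) → AllPos k → Any (λ p → hom G (H k) ≈ eval p k) ps

  IsStronglyPolynomial : ∀ {h} → ((Fin h → ℕ) → WGraph) → Set (c ⊔ ℓ)
  IsStronglyPolynomial {h} H = (G : Multigraph) → Σ (Poly Carrier h) λ p →
    (k : Fin h → ℕ) → AllPos k → hom G (H k) ≈ eval p k

  transformWt : ∀ {n} → Carrier → Carrier → Carrier → Carrier
              → (Fin n → Fin n → Carrier) → Fin n → Fin n → Carrier
  transformWt α β α' β' a i j with i ≟ j
  ... | yes _ = α' + β' * a i i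
  ... | no  _ = α + β * a i j

  transformWt-sym : ∀ {n} α β α' β' (a : Fin n → Fin n → Carrier)
    → (∀ i j → a i j ≈ a j i)
    → ∀ i j → transformWt α β α' β' a i j ≈ transformWt α β α' β' a j i
  transformWt-sym α β α' β' a s i j with i ≟ j | j ≟ i
  ... | yes P.refl | yes _ = CommutativeRing.refl R
  ... | yes P.refl | no ¬p = ⊥-elim' (¬p P.refl)
    where ⊥-elim' : ∀ {w} {W : Set w} → Data.Empty.⊥ → W
          ⊥-elim' ()
  ... | no ¬p | yes q = ⊥-elim' (¬p (P.sym q))
    where ⊥-elim' : ∀ {w} {W : Set w} → Data.Empty.⊥ → W
          ⊥-elim' ()
  ... | no _ | no _ = +-congˡ (*-congˡ (s i j))

  transform : Carrier → Carrier → Carrier → Carrier → WGraph → WGraph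
  transform α β α' β' H = mkWGraph (nVert H) (transformWt α β α' β' (wt H))
    (transformWt-sym α β α' β' (wt H) (sym-wt H))

-- Off the diagonal the new weight is α + β a_ij and on loops it exceeds that by (α′ − α) + (β′ − β) a_ii,
-- so ã_ij = α + β a_ij + [i = j] ((α′ − α) + (β′ − β) a_ij).  Expanding the product over the edges of G in
-- hom(G, H̃), each term is a constant times a product of original weights over some of the edges times
-- indicators [f u = f v]; summing over f, such an indicator contracts u and v.  Hence hom(G, H̃) is a
-- linear combination, with coefficients independent of H, of values hom(G′, H), and (strongly)
-- polynomial sequences are closed under such combinations.
module Submission where

open import Defs
open import Level using (Level; _⊔_)
open import Algebra.Bundles using (CommutativeRing)
open import Data.Nat using (ℕ)
open import Data.Fin using (Fin)
open import Data.Product using (_×_)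

open import Data.Nat.Base using (zero; suc)
open import Data.Fin.Base using (zero; suc; punchIn; punchOut)
open import Data.Fin.Properties using (_≟_; ¬Fin0; punchInᵢ≢i; punchIn-punchOut)
open import Data.Product using (Σ; _,_)
import Data.Product as Product
open import Data.List using (List; []; _∷_; _++_; map; cartesianProductWith)
open import Data.List.Relation.Unary.Any as Any using (Any; here)
open import Data.List.Relation.Unary.Any.Properties using (cartesianProductWith⁺)
open import Data.Vec.Functional using (insertAt; removeAt)
open import Data.Vec.Functional.Properties using (insertAt-lookup; insertAt-punchIn)
open import Function using (id; _∘_)
open import Relation.Nullary using (yes; no; contradiction)
open import Relation.Binary.PropositionalEquality as ≡ using (_≡_; _≢_; _≗_)
import Algebra.Solver.Ring.NaturalCoefficients.Default as SemiringSolver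
import Algebra.Properties.Group as GroupProperties
import Algebra.Properties.Semiring.Sum as SemiringSum
import Relation.Binary.Reasoning.Setoid as SetoidReasoning

insertAt-map : ∀ {A B : Set} {m} (h : A → B) (xs : Fin m → A) (v : Fin (suc m)) (x : A) →
               h ∘ insertAt xs v x ≗ insertAt (h ∘ xs) v (h x)
insertAt-map h xs zero    x zero    = ≡.refl
insertAt-map h xs zero    x (suc j) = ≡.refl
insertAt-map {m = suc m} h xs (suc v) x zero    = ≡.refl
insertAt-map {m = suc m} h xs (suc v) x (suc j) = insertAt-map h (xs ∘ suc) v x j

insertAt-cong : ∀ {A : Set} {m} {f g : Fin m → A} (v : Fin (suc m)) (x : A) →
                f ≗ g → insertAt f v x ≗ insertAt g v x
insertAt-cong zero    x f≗g zero    = ≡.refl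
insertAt-cong zero    x f≗g (suc j) = f≗g j
insertAt-cong {m = suc m} (suc v) x f≗g zero    = f≗g zero
insertAt-cong {m = suc m} (suc v) x f≗g (suc j) = insertAt-cong v x (f≗g ∘ suc) j

module _ {c ℓ} (R : CommutativeRing c ℓ) where
  open CommutativeRing R hiding (zero)
  open SemiringSum semiring
    using (sum; sum-cong-≋; sum-remove; sum-replicate-zero; ∑-distrib-+; ∑-comm; *-distribˡ-sum)
  open SetoidReasoning setoid
  open GroupProperties +-group using (//-rightDividesˡ)
  open SemiringSolver commutativeSemiring using (solve; _:=_; _:+_; _:*_)

  sumFin≡sum : ∀ n (f : Fin n → Carrier) → sumFin R n f ≡ sum f
  sumFin≡sum zero    f = ≡.refl
  sumFin≡sum (suc n) f = ≡.cong (f zero +_) (sumFin≡sum n (f ∘ suc))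

  sumFin-cong : ∀ n {f g : Fin n → Carrier} → (∀ i → f i ≈ g i) → sumFin R n f ≈ sumFin R n g
  sumFin-cong n {f} {g} f≈g = begin
    sumFin R n f ≡⟨ sumFin≡sum n f ⟩
    sum f        ≈⟨ sum-cong-≋ f≈g ⟩
    sum g        ≡⟨ sumFin≡sum n g ⟨
    sumFin R n g ∎

  sumFin-+ : ∀ n (f g : Fin n → Carrier) → sumFin R n (λ i → f i + g i) ≈ sumFin R n f + sumFin R n g
  sumFin-+ n f g = begin
    sumFin R n (λ i → f i + g i) ≡⟨ sumFin≡sum n _ ⟩
    sum (λ i → f i + g i)        ≈⟨ ∑-distrib-+ f g ⟩
    sum f + sum g                ≡⟨ ≡.cong₂ _+_ (sumFin≡sum n f) (sumFin≡sum n g) ⟨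
    sumFin R n f + sumFin R n g  ∎

  sumFin-*ˡ : ∀ n x (f : Fin n → Carrier) → sumFin R n (λ i → x * f i) ≈ x * sumFin R n f
  sumFin-*ˡ n x f = begin
    sumFin R n (λ i → x * f i) ≡⟨ sumFin≡sum n _ ⟩
    sum (λ i → x * f i)        ≈⟨ *-distribˡ-sum x f ⟨
    x * sum f                  ≡⟨ ≡.cong (x *_) (sumFin≡sum n f) ⟨
    x * sumFin R n f           ∎

  sumFin-comm : ∀ m n (f : Fin m → Fin n → Carrier) →
    sumFin R m (λ i → sumFin R n (f i)) ≈ sumFin R n (λ j → sumFin R m (λ i → f i j))
  sumFin-comm m n f = begin
    sumFin R m (λ i → sumFin R n (f i))                 ≡⟨ sumFin≡sum m _ ⟩
    sum (λ i → sumFin R n (f i))                        ≈⟨ sum-cong-≋ (λ i → reflexive (sumFin≡sum n (f i))) ⟩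
    sum (λ i → sum (f i))                               ≈⟨ ∑-comm f ⟩
    sum (λ j → sum (λ i → f i j))                       ≈⟨ sum-cong-≋ (λ j → reflexive (sumFin≡sum m (λ i → f i j))) ⟨
    sum (λ j → sumFin R m (λ i → f i j))                ≡⟨ sumFin≡sum n (λ j → sumFin R m (λ i → f i j)) ⟨
    sumFin R n (λ j → sumFin R m (λ i → f i j))         ∎

  δ : ∀ {n} → Fin n → Fin n → Carrier
  δ i j with i ≟ j
  ... | yes _ = 1#
  ... | no  _ = 0#

  δ-≡ : ∀ {n} {i j : Fin n} → i ≡ j → δ i j ≈ 1#
  δ-≡ {i = i} {j} i≡j with i ≟ j
  ... | yes _   = refl
  ... | no  i≢j = contradiction i≡j i≢j

  δ-≢ : ∀ {n} {i j : Fin n} → i ≢ j → δ i j ≈ 0#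
  δ-≢ {i = i} {j} i≢j with i ≟ j
  ... | yes i≡j = contradiction i≡j i≢j
  ... | no  _   = refl

  sumFin-δ : ∀ n (x : Fin n) (φ : Fin n → Carrier) → sumFin R n (λ i → δ x i * φ i) ≈ φ x
  sumFin-δ (suc n) x φ = begin
    sumFin R (suc n) t         ≡⟨ sumFin≡sum (suc n) t ⟩
    sum t                      ≈⟨ sum-remove {i = x} t ⟩
    t x + sum (removeAt t x)   ≈⟨ +-cong on-diagonal (trans (sum-cong-≋ off-diagonal) (sum-replicate-zero n)) ⟩
    φ x + 0#                   ≈⟨ +-identityʳ (φ x) ⟩
    φ x                        ∎
    where
    t : Fin (suc n) → Carrier
    t i = δ x i * φ i
    on-diagonal : t x ≈ φ x
    on-diagonal = trans (*-congʳ (δ-≡ {i = x} ≡.refl)) (*-identityˡ (φ x))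
    off-diagonal : ∀ j → t (punchIn x j) ≈ 0#
    off-diagonal j = trans (*-congʳ (δ-≢ (punchInᵢ≢i x j ∘ ≡.sym))) (zeroˡ _)

  Extensional : ∀ {m n} → ((Fin m → Fin n) → Carrier) → Set ℓ
  Extensional G = ∀ {f g} → f ≗ g → G f ≈ G g

  sumMaps-cong : ∀ m n {F G : (Fin m → Fin n) → Carrier} → (∀ f → F f ≈ G f) →
                 sumMaps R m n F ≈ sumMaps R m n G
  sumMaps-cong zero    n F≈G = F≈G _
  sumMaps-cong (suc m) n F≈G = sumFin-cong n (λ i → sumMaps-cong m n (λ g → F≈G _))

  sumMaps-+ : ∀ m n (F G : (Fin m → Fin n) → Carrier) →
              sumMaps R m n (λ f → F f + G f) ≈ sumMaps R m n F + sumMaps R m n G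
  sumMaps-+ zero    n F G = refl
  sumMaps-+ (suc m) n F G = trans (sumFin-cong n (λ i → sumMaps-+ m n _ _)) (sumFin-+ n _ _)

  sumMaps-*ˡ : ∀ m n x (F : (Fin m → Fin n) → Carrier) →
               sumMaps R m n (λ f → x * F f) ≈ x * sumMaps R m n F
  sumMaps-*ˡ zero    n x F = refl
  sumMaps-*ˡ (suc m) n x F = trans (sumFin-cong n (λ i → sumMaps-*ˡ m n x _)) (sumFin-*ˡ n x _)

  sumFin-sumMaps-comm : ∀ m n (F : Fin n → (Fin m → Fin n) → Carrier) →
    sumFin R n (λ i → sumMaps R m n (F i)) ≈ sumMaps R m n (λ g → sumFin R n (λ i → F i g))
  sumFin-sumMaps-comm zero    n F = refl
  sumFin-sumMaps-comm (suc m) n F =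
    trans (sumFin-comm n n _) (sumFin-cong n (λ j → sumFin-sumMaps-comm m n _))

  sumMaps-insertAt : ∀ m n (v : Fin (suc m)) (G : (Fin (suc m) → Fin n) → Carrier) → Extensional G →
    sumMaps R (suc m) n G ≈ sumFin R n (λ i → sumMaps R m n (λ g → G (insertAt g v i)))
  sumMaps-insertAt m n zero G G-ext =
    sumFin-cong n (λ i → sumMaps-cong m n (λ g → G-ext λ { zero → ≡.refl ; (suc x) → ≡.refl }))
  sumMaps-insertAt (suc m) n (suc v) G G-ext = begin
    sumMaps R (suc (suc m)) n G
      ≈⟨ sumMaps-insertAt (suc m) n zero G G-ext ⟩
    sumFin R n (λ j → sumMaps R (suc m) n (λ g → G (insertAt g zero j)))
      ≈⟨ sumFin-cong n (λ j → sumMaps-insertAt m n v _ (λ f≗g → G-ext (insertAt-cong zero j f≗g))) ⟩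
    sumFin R n (λ j → sumFin R n (λ i → sumMaps R m n (λ g → G (insertAt (insertAt g v i) zero j))))
      ≈⟨ sumFin-comm n n _ ⟩
    sumFin R n (λ i → sumFin R n (λ j → sumMaps R m n (λ g → G (insertAt (insertAt g v i) zero j))))
      ≈⟨ sumFin-cong n (λ i → sumFin-cong n (λ j → sumMaps-cong m n (λ g →
           G-ext λ { zero → ≡.refl ; (suc x) → ≡.refl }))) ⟩
    sumFin R n (λ i → sumFin R n (λ j → sumMaps R m n (λ g → G (insertAt (insertAt g zero j) (suc v) i))))
      ≈⟨ sumFin-cong n (λ i → sumMaps-insertAt m n zero _ (λ f≗g → G-ext (insertAt-cong (suc v) i f≗g))) ⟨
    sumFin R n (λ i → sumMaps R (suc m) n (λ g → G (insertAt g (suc v) i)))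
      ∎

  -- insertAt id v u : Fin (suc m) → Fin m merges vertex v into u and renumbers the others.
  sumMaps-contract : ∀ m n (v : Fin (suc m)) (u : Fin m) (G : (Fin (suc m) → Fin n) → Carrier) →
    Extensional G →
    sumMaps R (suc m) n (λ f → δ (f (punchIn v u)) (f v) * G f) ≈
    sumMaps R m n (λ g → G (g ∘ insertAt id v u))
  sumMaps-contract m n v u G G-ext = begin
    sumMaps R (suc m) n (λ f → δ (f (punchIn v u)) (f v) * G f)
      ≈⟨ sumMaps-insertAt m n v _ (λ f≗g → *-cong (reflexive (≡.cong₂ δ (f≗g _) (f≗g v))) (G-ext f≗g)) ⟩
    sumFin R n (λ i → sumMaps R m n (λ g →
      δ (insertAt g v i (punchIn v u)) (insertAt g v i v) * G (insertAt g v i)))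
      ≈⟨ sumFin-cong n (λ i → sumMaps-cong m n (λ g →
           *-congʳ (reflexive (≡.cong₂ δ (insertAt-punchIn g v i u) (insertAt-lookup g v i))))) ⟩
    sumFin R n (λ i → sumMaps R m n (λ g → δ (g u) i * G (insertAt g v i)))
      ≈⟨ sumFin-sumMaps-comm m n _ ⟩
    sumMaps R m n (λ g → sumFin R n (λ i → δ (g u) i * G (insertAt g v i)))
      ≈⟨ sumMaps-cong m n (λ g → sumFin-δ n (g u) _) ⟩
    sumMaps R m n (λ g → G (insertAt g v (g u)))
      ≈⟨ sumMaps-cong m n (λ g → G-ext (insertAt-map g id v u)) ⟨
    sumMaps R m n (λ g → G (g ∘ insertAt id v u))
      ∎

  LinearCombination : Set c
  LinearCombination = List (Carrier × Multigraph)

  homCombination : LinearCombination → WGraph R → Carrier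
  homCombination []            H = 0#
  homCombination ((a , G) ∷ L) H = a * hom R G H + homCombination L H

  homCombination-++ : ∀ L L′ H → homCombination (L ++ L′) H ≈ homCombination L H + homCombination L′ H
  homCombination-++ []            L′ H = sym (+-identityˡ _)
  homCombination-++ ((a , G) ∷ L) L′ H =
    trans (+-congˡ (homCombination-++ L L′ H)) (sym (+-assoc _ _ _))

  MapWeight : ℕ → Set (c ⊔ ℓ)
  MapWeight m = (H : WGraph R) → (Fin m → Fin (nVert H)) → Carrier

  Representable : ∀ m → MapWeight m → Set (c ⊔ ℓ)
  Representable m F = Σ LinearCombination λ L → ∀ H → sumMaps R m (nVert H) (F H) ≈ homCombination L H

  -- Representable after pulling back along every ρ, i.e. after any identification of vertices.
  record StablyRepresentable {m₀} (Φ : MapWeight m₀) : Set (c ⊔ ℓ) where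
    field along : ∀ m (ρ : Fin m₀ → Fin m) → Representable m (λ H f → Φ H (f ∘ ρ))
  open StablyRepresentable

  stably-cong : ∀ {m₀} {Φ Ψ : MapWeight m₀} → (∀ H g → Φ H g ≈ Ψ H g) →
                StablyRepresentable Φ → StablyRepresentable Ψ
  stably-cong Φ≈Ψ Φ-rep .along m ρ =
    let L , sum≈L = Φ-rep .along m ρ in
    L , λ H → trans (sym (sumMaps-cong m (nVert H) (λ f → Φ≈Ψ H (f ∘ ρ)))) (sum≈L H)

  stably-+ : ∀ {m₀} {Φ Ψ : MapWeight m₀} → StablyRepresentable Φ → StablyRepresentable Ψ →
             StablyRepresentable (λ H g → Φ H g + Ψ H g)
  stably-+ Φ-rep Ψ-rep .along m ρ =
    let L , sum≈L = Φ-rep .along m ρ ; L′ , sum≈L′ = Ψ-rep .along m ρ in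
    L ++ L′ , λ H → trans (sumMaps-+ m (nVert H) _ _)
                          (trans (+-cong (sum≈L H) (sum≈L′ H)) (sym (homCombination-++ L L′ H)))

  prodEdges-cong : ∀ {m n} (w : Fin n → Fin n → Carrier) {f g : Fin m → Fin n} → f ≗ g →
                   ∀ es → prodEdges R w f es ≡ prodEdges R w g es
  prodEdges-cong w f≗g []             = ≡.refl
  prodEdges-cong w f≗g ((u , v) ∷ es) = ≡.cong₂ _*_ (≡.cong₂ w (f≗g u) (f≗g v)) (prodEdges-cong w f≗g es)

  prodEdges-∘ : ∀ {m₀ m n} (w : Fin n → Fin n → Carrier) (f : Fin m → Fin n) (ρ : Fin m₀ → Fin m) es →
                prodEdges R w (f ∘ ρ) es ≡ prodEdges R w f (map (Product.map ρ ρ) es)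
  prodEdges-∘ w f ρ []             = ≡.refl
  prodEdges-∘ w f ρ ((u , v) ∷ es) = ≡.cong (w (f (ρ u)) (f (ρ v)) *_) (prodEdges-∘ w f ρ es)

  stably-prodEdges : ∀ {m₀} a (es : List (Fin m₀ × Fin m₀)) →
                     StablyRepresentable (λ H g → a * prodEdges R (wt H) g es)
  stably-prodEdges a es .along m ρ =
    (a , mkMultigraph m (map (Product.map ρ ρ) es)) ∷ [] , λ H →
      trans (sumMaps-cong m (nVert H) (λ f → *-congˡ (reflexive (prodEdges-∘ (wt H) f ρ es))))
            (trans (sumMaps-*ˡ m (nVert H) a _) (sym (+-identityʳ _)))

  -- Where ρ identifies u and v nothing changes; otherwise contracting the two vertices lowers m.
  stably-δ : ∀ {m₀} {Φ : MapWeight m₀} → (∀ H → Extensional (Φ H)) → StablyRepresentable Φ →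
             ∀ u v → StablyRepresentable (λ H g → δ (g u) (g v) * Φ H g)
  stably-δ Φ-ext Φ-rep u v .along zero ρ = contradiction (ρ u) ¬Fin0
  stably-δ {Φ = Φ} Φ-ext Φ-rep u v .along m@(suc _) ρ with ρ u ≟ ρ v
  ... | yes ρu≡ρv =
    let L , sum≈L = Φ-rep .along m ρ in
    L , λ H → trans (sumMaps-cong m (nVert H) (δ-disappears H)) (sum≈L H)
    where
    δ-disappears : ∀ H f → δ (f (ρ u)) (f (ρ v)) * Φ H (f ∘ ρ) ≈ Φ H (f ∘ ρ)
    δ-disappears H f = trans (*-congʳ (δ-≡ (≡.cong f ρu≡ρv))) (*-identityˡ _)
  stably-δ {Φ = Φ} Φ-ext Φ-rep u v .along (suc m) ρ | no ρu≢ρv =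
    let L , sum≈L = Φ-rep .along m (insertAt id (ρ v) u′ ∘ ρ) in
    L , λ H → trans (sumMaps-cong (suc m) (nVert H) (relabel H))
                    (trans (sumMaps-contract m (nVert H) (ρ v) u′ (Φ H ∘ (_∘ ρ)) (Φ-ext H ∘ (_∘ ρ)))
                           (sum≈L H))
    where
    ρv≢ρu : ρ v ≢ ρ u
    ρv≢ρu = ρu≢ρv ∘ ≡.sym
    u′ : Fin m
    u′ = punchOut ρv≢ρu
    relabel : ∀ H f → δ (f (ρ u)) (f (ρ v)) * Φ H (f ∘ ρ) ≈
                      δ (f (punchIn (ρ v) u′)) (f (ρ v)) * Φ H (f ∘ ρ)
    relabel H f = *-congʳ (reflexive (≡.cong (λ x → δ (f x) (f (ρ v))) (≡.sym (punchIn-punchOut ρv≢ρu))))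

  module _ (α β α′ β′ : Carrier) where

    transformWt-split : ∀ {n} (a : Fin n → Fin n → Carrier) i j →
      transformWt R α β α′ β′ a i j ≈ (α + β * a i j) + δ i j * ((α′ - α) + (β′ - β) * a i j)
    transformWt-split a i j with i ≟ j
    ... | yes ≡.refl = sym (begin
      (α + β * x) + 1# * ((α′ - α) + (β′ - β) * x) ≈⟨ +-congˡ (*-identityˡ _) ⟩
      (α + β * x) + ((α′ - α) + (β′ - β) * x)      ≈⟨ regroup α β (α′ - α) (β′ - β) x ⟩
      ((α′ - α) + α) + ((β′ - β) + β) * x          ≈⟨ +-cong (//-rightDividesˡ α α′) (*-congʳ (//-rightDividesˡ β β′)) ⟩
      α′ + β′ * x                                  ∎)
      where
      x = a i i
      regroup : ∀ α β p q x → (α + β * x) + (p + q * x) ≈ (p + α) + (q + β) * x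
      regroup = solve 5 (λ α β p q x →
        ((α :+ β :* x) :+ (p :+ q :* x)) := ((p :+ α) :+ (q :+ β) :* x)) refl
    ... | no _ = sym (trans (+-congˡ (zeroˡ _)) (+-identityʳ _))

    -- a summand of hom(G, transform H) during the expansion: coefficient a, original weights on the
    -- edges of as, transformed weights on those of es
    weight : ∀ {m₀} → List (Fin m₀ × Fin m₀) → Carrier → List (Fin m₀ × Fin m₀) → MapWeight m₀
    weight es a as H g =
      a * (prodEdges R (wt H) g as * prodEdges R (transformWt R α β α′ β′ (wt H)) g es)

    weight-split : ∀ {m₀} u v (es : List (Fin m₀ × Fin m₀)) a as H g →
      weight ((u , v) ∷ es) a as H g ≈
        (weight es (a * α) as H g + weight es (a * β) ((u , v) ∷ as) H g)
        + (δ (g u) (g v) * weight es (a * (α′ - α)) as H g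
           + δ (g u) (g v) * weight es (a * (β′ - β)) ((u , v) ∷ as) H g)
    weight-split u v es a as H g =
      trans (*-congˡ (*-congˡ (*-congʳ (transformWt-split (wt H) (g u) (g v)))))
            (expand a _ _ (wt H (g u) (g v)) (δ (g u) (g v)) α β (α′ - α) (β′ - β))
      where
      expand : ∀ a A B x d α β p q →
        a * (A * (((α + β * x) + d * (p + q * x)) * B)) ≈
          ((a * α) * (A * B) + (a * β) * ((x * A) * B))
          + (d * ((a * p) * (A * B)) + d * ((a * q) * ((x * A) * B)))
      expand = solve 9 (λ a A B x d α β p q →
        (a :* (A :* (((α :+ β :* x) :+ d :* (p :+ q :* x)) :* B))) :=
          (((a :* α) :* (A :* B) :+ (a :* β) :* ((x :* A) :* B))
           :+ (d :* ((a :* p) :* (A :* B)) :+ d :* ((a :* q) :* ((x :* A) :* B))))) refl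

    weight-extensional : ∀ {m₀} (es : List (Fin m₀ × Fin m₀)) a as H → Extensional (weight es a as H)
    weight-extensional es a as H f≗g =
      *-congˡ (*-cong (reflexive (prodEdges-cong _ f≗g as)) (reflexive (prodEdges-cong _ f≗g es)))

    weight-stable : ∀ {m₀} (es : List (Fin m₀ × Fin m₀)) a as → StablyRepresentable (weight es a as)
    weight-stable []             a as =
      stably-cong (λ H g → *-congˡ (sym (*-identityʳ _))) (stably-prodEdges a as)
    weight-stable ((u , v) ∷ es) a as =
      stably-cong (λ H g → sym (weight-split u v es a as H g))
        (stably-+ (stably-+ (weight-stable es (a * α) as)
                            (weight-stable es (a * β) ((u , v) ∷ as)))
                  (stably-+ (stably-δ (weight-extensional es _ as) (weight-stable es (a * (α′ - α)) as) u v)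
                            (stably-δ (weight-extensional es _ ((u , v) ∷ as))
                                      (weight-stable es (a * (β′ - β)) ((u , v) ∷ as)) u v)))

    hom-transform-combination : ∀ G → Σ LinearCombination λ L →
      ∀ H → hom R G (transform R α β α′ β′ H) ≈ homCombination L H
    hom-transform-combination G =
      let L , sum≈L = weight-stable (edges G) 1# [] .along (nV G) id in
      L , λ H → trans (sumMaps-cong (nV G) (nVert H) (λ f → sym (trans (*-identityˡ _) (*-identityˡ _))))
                      (sum≈L H)

  module _ {h} (H : (Fin h → ℕ) → WGraph R) where

    homCombination-polynomial : IsPolynomial R H → ∀ L → Σ (List (Poly Carrier h)) λ ps →
      ∀ k → AllPos k → Any (λ p → homCombination L (H k) ≈ eval R p k) ps
    homCombination-polynomial poly []            = const 0# ∷ [] , λ _ _ → here refl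
    homCombination-polynomial poly ((a , G) ∷ L) =
      let ps , hom∈ps = poly G ; qs , L∈qs = homCombination-polynomial poly L in
      cartesianProductWith combine ps qs , λ k k>0 →
        cartesianProductWith⁺ combine {P = λ p → hom R G (H k) ≈ eval R p k}
          {Q = λ q → homCombination L (H k) ≈ eval R q k}
          (λ hom≈p L≈q → +-cong (*-congˡ hom≈p) L≈q) (hom∈ps k k>0) (L∈qs k k>0)
      where
      combine : Poly Carrier h → Poly Carrier h → Poly Carrier h
      combine p q = (const a ⊗ p) ⊕ q

    homCombination-stronglyPolynomial : IsStronglyPolynomial R H → ∀ L → Σ (Poly Carrier h) λ p →
      ∀ k → AllPos k → homCombination L (H k) ≈ eval R p k
    homCombination-stronglyPolynomial poly []            = const 0# , λ _ _ → refl
    homCombination-stronglyPolynomial poly ((a , G) ∷ L) =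
      let p , hom≈p = poly G ; q , L≈q = homCombination-stronglyPolynomial poly L in
      (const a ⊗ p) ⊕ q , λ k k>0 → +-cong (*-congˡ (hom≈p k k>0)) (L≈q k k>0)

proposition3p3 : {c ℓ : Level} (R : CommutativeRing c ℓ) (h : ℕ)
    (H : (Fin h → ℕ) → WGraph R)
    (α β α′ β′ : CommutativeRing.Carrier R) →
    (IsPolynomial R H → IsPolynomial R (λ k → transform R α β α′ β′ (H k)))
    × (IsStronglyPolynomial R H → IsStronglyPolynomial R (λ k → transform R α β α′ β′ (H k)))
proposition3p3 R h H α β α′ β′ =
  (λ poly G →
    let L , hom≈L = hom-transform-combination R α β α′ β′ G
        ps , L∈ps = homCombination-polynomial R H poly L
    in ps , λ k k>0 → Any.map (trans (hom≈L (H k))) (L∈ps k k>0))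
  , (λ poly G →
    let L , hom≈L = hom-transform-combination R α β α′ β′ G
        p , L≈p = homCombination-stronglyPolynomial R H poly L
    in p , λ k k>0 → trans (hom≈L (H k)) (L≈p k k>0))
  where open CommutativeRing R using (trans)
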